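{- Let $g_1,\dots,g_k\in\Omega$. The product $g_1\cdots g_k$ is an odometer if and only if $g_{\tau(1)}^{\ell_1}\cdots g_{\tau(k)}^{\ell_k}$ is an odometer for every permutation $\tau\in S_k$ and every $\ell_1,\dots,\ell_k\in\mathbb{Z}_2^\times$.
   Context: $T$ is the regular rooted binary tree whose vertices are finite words over $\{0,1\}$ (level $n$ = words of length $n$), and $\Omega=\mathrm{Aut}(T)$ with its profinite topology (inverse limit of the automorphism groups of the truncations to levels $\le n$). An odometer is an element acting as a single $2^n$-cycle on level $n$ for every $n\ge1$. For $\gamma\in\Omega$ and a $2$-adic integer $\ell$ represented by integers $\ell_n$ with $\ell_{n+1}\equiv\ell_n\pmod{2^n}$ converging to $\ell$, $\gamma^\ell$ denotes the limit in $\Omega$ of $\gamma^{\ell_n}$. $\mathbb{Z}_2^\times$ is the group of $2$-adic units. -}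

module Defs where

open import Data.Bool using (Bool; true; false; _xor_)
open import Data.List using (List; []; _∷_)
open import Data.Vec using (Vec; []; _∷_; toList)
open import Data.Nat using (ℕ; zero; suc; _+_; _*_; _^_; _≤_; NonZero)
open import Data.Nat.Properties using (m^n≢0)
open import Data.Nat.DivMod using (_%_; m%n<n)
open import Data.Fin using (Fin; toℕ; fromℕ<)
import Data.Fin as F
open import Data.Product using (Σ; ∃; _×_; _,_)
open import Function.Bundles using (_⤖_; Bijection)
open import Relation.Binary.PropositionalEquality using (_≡_)

-- Ω = Aut(T), an automorphism represented by its portrait:
-- the label at vertex w says whether the two children of w are swapped.
Ω : Set
Ω = List Bool → Bool

sec : Ω → Bool → Ω
sec p b = λ w → p (b ∷ w)

act : Ω → ∀ {n} → Vec Bool n → Vec Bool n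
act p []       = []
act p (b ∷ w)  = (b xor p []) ∷ act (sec p b) w

actL : Ω → List Bool → List Bool
actL p []      = []
actL p (b ∷ w) = (b xor p []) ∷ actL (sec p b) w

idΩ : Ω
idΩ _ = false

-- product: (g · h) acts as g ∘ h  (first h, then g)
_·_ : Ω → Ω → Ω
(g · h) w = h w xor g (actL h w)

pow : Ω → ℕ → Ω
pow g zero    = idΩ
pow g (suc m) = g · pow g m

prod : ∀ k → (Fin k → Ω) → Ω
prod zero    g = idΩ
prod (suc k) g = g F.zero · prod k (λ i → g (F.suc i))

-- 2-adic integers as digit streams: ℓ = Σ d i 2^i
ℤ₂ : Set
ℤ₂ = ℕ → Bool

bit : Bool → ℕ
bit true  = 1
bit false = 0

trunc : ℤ₂ → ℕ → ℕ
trunc d zero    = 0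
trunc d (suc n) = trunc d n + bit (d n) * 2 ^ n

-- 2-adic units: the odd 2-adic integers
IsUnit : ℤ₂ → Set
IsUnit d = d 0 ≡ true

-- convergence in the profinite topology of Ω: eventually agree on each level
_⟶_ : (ℕ → Ω) → Ω → Set
s ⟶ δ = ∀ m → ∃ λ N → ∀ n → N ≤ n → ∀ (w : Vec Bool m) → act (s n) w ≡ act δ w

IsPow : Ω → ℤ₂ → Ω → Set
IsPow γ ℓ δ = (λ n → pow γ (trunc ℓ n)) ⟶ δ

succMod2^ : ∀ n → Fin (2 ^ n) → Fin (2 ^ n)
succMod2^ n i = fromℕ< (m%n<n (suc (toℕ i)) (2 ^ n) {{m^n≢0 2 n}})
  where instance _ = m^n≢0 2 n

SingleCycleOnLevel : Ω → ℕ → Set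
SingleCycleOnLevel γ n =
  Σ (Fin (2 ^ n) ⤖ Vec Bool n) λ e →
    ∀ i → act γ (Bijection.to e i) ≡ Bijection.to e (succMod2^ n i)

IsOdometer : Ω → Set
IsOdometer γ = ∀ n → 1 ≤ n → SingleCycleOnLevel γ n

{-# OPTIONS --safe #-}
-- Let σₙ(γ) = labelParity n γ ∈ ℤ/2 be the sum of the portrait labels of γ on level n. Each σₙ is a
-- homomorphism Ω → ℤ/2 that only depends on the action on level n + 1, and γ is an
-- odometer iff σₙ(γ) = 1 for every n: when the root label is 1, γ² preserves both
-- subtrees and its section at either one has σₙ equal to σₙ₊₁(γ), so transitivity
-- and the exact period 2ⁿ pass down the tree. For a 2-adic unit ℓ every truncation
-- ℓₙ is odd, hence σₙ(γ^ℓ) = σₙ(γ), and as ℤ/2 is commutative σₙ of any product of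
-- unit powers of the gᵢ in any order equals σₙ(g₁ ⋯ gₖ).
module Submission where

open import Defs
open import Data.Nat using (ℕ)
open import Data.Fin using (Fin)
open import Data.Fin.Permutation using (Permutation′; _⟨$⟩ʳ_)
open import Data.Product using (_×_)
open import Function.Bundles using (_⇔_)

open import Algebra.Bundles using (CommutativeRing)
import Algebra.Properties.CommutativeMonoid.Sum as CommutativeMonoidSum
import Algebra.Properties.CommutativeSemigroup as CommutativeSemigroupProperties
open import Data.Bool using (Bool; true; false; not; _xor_)
open import Data.Bool.Properties
  using (xor-comm; xor-assoc; xor-same; xor-identityʳ; not-involutive; not-¬; ¬-not; xor-∧-commutativeRing)
open import Data.Empty using (⊥-elim)
open import Data.List using ([])
open import Data.Fin using (toℕ; fromℕ<)
import Data.Fin as F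
open import Data.Fin.Properties using (toℕ-fromℕ<; toℕ-injective; toℕ<n)
import Data.Fin.Permutation as Perm
open import Data.Nat using (zero; suc; _+_; _*_; _^_; _∸_; _≤_; _<_; NonZero; z≤n; s≤s)
open import Data.Nat.Properties
  using (+-suc; +-identityʳ; +-comm; +-assoc; m^n≢0; n≤1+n; ≤-total; ≤-<-trans; m∸n+n≡m; m+[n∸m]≡n; <⇒≤)
open import Data.Nat.DivMod
  using (_%_; _/_; m%n<n; m≡m%n+[m/n]*n; m%n%n≡m%n; %-distribˡ-+; %-remove-+ˡ; [m+n]%n≡m%n; m<n⇒m%n≡m)
open import Data.Nat.Divisibility using (_∣_; 1∣_; *-monoʳ-∣)
open import Data.Nat.GeneralisedArithmetic using (fold; fold-+)
open import Data.Nat.Solver using (module +-*-Solver)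
open import Data.Product using (Σ; ∃; _,_)
open import Data.Sum using (inj₁; inj₂)
open import Data.Vec using (Vec; []; _∷_; head; tail; replicate)
open import Function.Base using (_∘_)
open import Function.Bundles using (_⤖_; Bijection; mk⤖; mk⇔)
open import Relation.Binary.PropositionalEquality
  using (_≡_; refl; sym; trans; cong; cong₂; subst; module ≡-Reasoning)

open ≡-Reasoning

data EvenOdd : ℕ → Set where
  even : ∀ q → EvenOdd (q + q)
  odd  : ∀ q → EvenOdd (suc (q + q))

evenOdd : ∀ m → EvenOdd m
evenOdd zero = even zero
evenOdd (suc m) with evenOdd m
... | even q = odd q
... | odd q  = subst EvenOdd (cong suc (+-suc q q)) (even (suc q))

fold-natural : ∀ {A B : Set} {f : A → A} {g : B → B} (h : A → B) →
               (∀ x → h (f x) ≡ g (h x)) → ∀ x m → h (fold x f m) ≡ fold (h x) g m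
fold-natural h comm x zero    = refl
fold-natural {g = g} h comm x (suc m) = trans (comm _) (cong g (fold-natural h comm x m))

sucMod : ∀ N .{{_ : NonZero N}} → Fin N → Fin N
sucMod N i = fromℕ< (m%n<n (suc (toℕ i)) N)

module _ {A : Set} (f : A → A) where

  SingleOrbit : Set
  SingleOrbit = ∀ x y → ∃ λ m → fold x f m ≡ y

  SingleCycle : ∀ N .{{_ : NonZero N}} → Set
  SingleCycle N = Σ (Fin N ⤖ A) λ e → ∀ i → f (Bijection.to e i) ≡ Bijection.to e (sucMod N i)

module _ {N : ℕ} .{{_ : NonZero N}} where

  toℕ-fold-sucMod : ∀ (i : Fin N) m → toℕ (fold i (sucMod N) m) ≡ (toℕ i + m) % N
  toℕ-fold-sucMod i zero = begin
    toℕ i             ≡⟨ m<n⇒m%n≡m (toℕ<n i) ⟨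
    toℕ i % N         ≡⟨ cong (_% N) (+-identityʳ (toℕ i)) ⟨
    (toℕ i + 0) % N   ∎
  toℕ-fold-sucMod i (suc m) = begin
    toℕ (sucMod N (fold i (sucMod N) m)) ≡⟨ toℕ-fromℕ< (m%n<n (suc (toℕ (fold i (sucMod N) m))) N) ⟩
    suc (toℕ (fold i (sucMod N) m)) % N  ≡⟨ cong (λ a → suc a % N) (toℕ-fold-sucMod i m) ⟩
    suc ((toℕ i + m) % N) % N            ≡⟨ %-distribˡ-+ 1 ((toℕ i + m) % N) N ⟩
    (1 % N + (toℕ i + m) % N % N) % N    ≡⟨ cong (λ a → (1 % N + a) % N) (m%n%n≡m%n (toℕ i + m) N) ⟩
    (1 % N + (toℕ i + m) % N) % N        ≡⟨ %-distribˡ-+ 1 (toℕ i + m) N ⟨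
    suc (toℕ i + m) % N                  ≡⟨ cong (_% N) (+-suc (toℕ i) m) ⟨
    (toℕ i + suc m) % N                  ∎

  sucMod-transitive : ∀ (i j : Fin N) → ∃ λ m → fold i (sucMod N) m ≡ j
  sucMod-transitive i j = N ∸ toℕ i + toℕ j , toℕ-injective (begin
    toℕ (fold i (sucMod N) (N ∸ toℕ i + toℕ j)) ≡⟨ toℕ-fold-sucMod i (N ∸ toℕ i + toℕ j) ⟩
    (toℕ i + (N ∸ toℕ i + toℕ j)) % N           ≡⟨ cong (_% N) (+-assoc (toℕ i) (N ∸ toℕ i) (toℕ j)) ⟨
    (toℕ i + (N ∸ toℕ i) + toℕ j) % N           ≡⟨ cong (λ a → (a + toℕ j) % N) (m+[n∸m]≡n (<⇒≤ (toℕ<n i))) ⟩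
    (N + toℕ j) % N                             ≡⟨ cong (_% N) (+-comm N (toℕ j)) ⟩
    (toℕ j + N) % N                             ≡⟨ [m+n]%n≡m%n (toℕ j) N ⟩
    toℕ j % N                                   ≡⟨ m<n⇒m%n≡m (toℕ<n j) ⟩
    toℕ j                                       ∎)

module _ {A : Set} {f : A → A} {N : ℕ} .{{_ : NonZero N}} where

  singleCycle⇒singleOrbit : SingleCycle f N → SingleOrbit f
  singleCycle⇒singleOrbit (e , cycle) x y
    with Bijection.strictlySurjective e x | Bijection.strictlySurjective e y
  ... | i , refl | j , refl with sucMod-transitive i j
  ... | m , refl = m , sym (fold-natural (Bijection.to e) (λ i → sym (cycle i)) i m)

  singleCycle-fromOrbit : (x₀ : A) → (∀ y → ∃ λ m → fold x₀ f m ≡ y) → fold x₀ f N ≡ x₀ →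
                          (∀ y m → fold y f m ≡ y → N ∣ m) → SingleCycle f N
  singleCycle-fromOrbit x₀ reach period period-∣ = mk⤖ (orbit-injective , orbit-surjective) , orbit-sucMod
    where
    orbit : Fin N → A
    orbit i = fold x₀ f (toℕ i)

    fold-multiple : ∀ q → fold x₀ f (q * N) ≡ x₀
    fold-multiple zero    = refl
    fold-multiple (suc q) = begin
      fold x₀ f (N + q * N)        ≡⟨ fold-+ x₀ f N ⟩
      fold (fold x₀ f (q * N)) f N ≡⟨ cong (λ x → fold x f N) (fold-multiple q) ⟩
      fold x₀ f N                  ≡⟨ period ⟩
      x₀                           ∎

    fold-% : ∀ m → fold x₀ f (m % N) ≡ fold x₀ f m
    fold-% m = sym (begin
      fold x₀ f m                             ≡⟨ cong (fold x₀ f) (m≡m%n+[m/n]*n m N) ⟩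
      fold x₀ f (m % N + m / N * N)           ≡⟨ fold-+ x₀ f (m % N) ⟩
      fold (fold x₀ f (m / N * N)) f (m % N)  ≡⟨ cong (λ x → fold x f (m % N)) (fold-multiple (m / N)) ⟩
      fold x₀ f (m % N)                       ∎)

    orbit-sucMod : ∀ i → f (orbit i) ≡ orbit (sucMod N i)
    orbit-sucMod i = begin
      fold x₀ f (suc (toℕ i))        ≡⟨ fold-% (suc (toℕ i)) ⟨
      fold x₀ f (suc (toℕ i) % N)    ≡⟨ cong (fold x₀ f) (toℕ-fromℕ< (m%n<n (suc (toℕ i)) N)) ⟨
      orbit (sucMod N i)             ∎

    fold-injective : ∀ {a b} → a ≤ b → b < N → fold x₀ f a ≡ fold x₀ f b → a ≡ b
    fold-injective {a} {b} a≤b b<N eq = begin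
      a                   ≡⟨ m<n⇒m%n≡m (≤-<-trans a≤b b<N) ⟨
      a % N               ≡⟨ %-remove-+ˡ a N∣b∸a ⟨
      (b ∸ a + a) % N     ≡⟨ cong (_% N) (m∸n+n≡m a≤b) ⟩
      b % N               ≡⟨ m<n⇒m%n≡m b<N ⟩
      b                   ∎
      where
      N∣b∸a : N ∣ b ∸ a
      N∣b∸a = period-∣ (fold x₀ f a) (b ∸ a) (begin
        fold (fold x₀ f a) f (b ∸ a) ≡⟨ fold-+ x₀ f (b ∸ a) ⟨
        fold x₀ f (b ∸ a + a)        ≡⟨ cong (fold x₀ f) (m∸n+n≡m a≤b) ⟩
        fold x₀ f b                  ≡⟨ eq ⟨
        fold x₀ f a                  ∎)

    orbit-injective : ∀ {i j} → orbit i ≡ orbit j → i ≡ j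
    orbit-injective {i} {j} eq with ≤-total (toℕ i) (toℕ j)
    ... | inj₁ i≤j = toℕ-injective (fold-injective i≤j (toℕ<n j) eq)
    ... | inj₂ j≤i = toℕ-injective (sym (fold-injective j≤i (toℕ<n i) (sym eq)))

    orbit-surjective : ∀ y → ∃ λ i → ∀ {z} → z ≡ i → orbit z ≡ y
    orbit-surjective y with reach y
    ... | m , refl = fromℕ< (m%n<n m N) , λ { refl →
      trans (cong (fold x₀ f) (toℕ-fromℕ< (m%n<n m N))) (fold-% m) }

act-· : ∀ g h {n} (w : Vec Bool n) → act (g · h) w ≡ act g (act h w)
act-· g h []      = refl
act-· g h (b ∷ w) = cong₂ _∷_ (sym (xor-assoc b (h []) (g []))) (act-· (sec g (b xor h [])) (sec h b) w)

act-idΩ : ∀ {n} (w : Vec Bool n) → act idΩ w ≡ w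
act-idΩ []      = refl
act-idΩ (b ∷ w) = cong₂ _∷_ (xor-identityʳ b) (act-idΩ w)

act-pow : ∀ γ m {n} (w : Vec Bool n) → act (pow γ m) w ≡ fold w (act γ) m
act-pow γ zero    w = act-idΩ w
act-pow γ (suc m) w = trans (act-· γ (pow γ m) w) (cong (act γ) (act-pow γ m w))

head-act : ∀ γ {n} (v : Vec Bool (suc n)) → head (act γ v) ≡ head v xor γ []
head-act γ (b ∷ w) = refl

head-fold-act : ∀ {γ} → γ [] ≡ false → ∀ m {n} (v : Vec Bool (suc n)) → head (fold v (act γ) m) ≡ head v
head-fold-act fixes zero    v = refl
head-fold-act {γ} fixes (suc m) v = begin
  head (act γ (fold v (act γ) m))      ≡⟨ head-act γ (fold v (act γ) m) ⟩
  head (fold v (act γ) m) xor γ []     ≡⟨ cong₂ _xor_ (head-fold-act fixes m v) fixes ⟩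
  head v xor false                     ≡⟨ xor-identityʳ (head v) ⟩
  head v                               ∎

-- When the root label is set, γ² fixes both subtrees and acts on the subtree at b as sec² γ b.
sec² : Ω → Bool → Ω
sec² γ b = sec γ (not b) · sec γ b

module _ {γ : Ω} (swaps : γ [] ≡ true) where

  act-swap : ∀ b {n} (x : Vec Bool n) → act γ (b ∷ x) ≡ not b ∷ act (sec γ b) x
  act-swap false x rewrite swaps = refl
  act-swap true  x rewrite swaps = refl

  fold-act-even : ∀ q b {n} (x : Vec Bool n) → fold (b ∷ x) (act γ) (q + q) ≡ b ∷ fold x (act (sec² γ b)) q
  fold-act-even zero    b x = refl
  fold-act-even (suc q) b {n} x = begin
    fold (b ∷ x) (act γ) (suc q + suc q)                 ≡⟨ cong (λ m → fold (b ∷ x) (act γ) (suc m)) (+-suc q q) ⟩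
    act γ (act γ (fold (b ∷ x) (act γ) (q + q)))         ≡⟨ cong (act γ ∘ act γ) (fold-act-even q b x) ⟩
    act γ (act γ (b ∷ y))                                ≡⟨ cong (act γ) (act-swap b y) ⟩
    act γ (not b ∷ act (sec γ b) y)                      ≡⟨ act-swap (not b) (act (sec γ b) y) ⟩
    not (not b) ∷ act (sec γ (not b)) (act (sec γ b) y)  ≡⟨ cong₂ _∷_ (not-involutive b) (sym (act-· (sec γ (not b)) (sec γ b) y)) ⟩
    b ∷ act (sec² γ b) y                                 ∎
    where
    y : Vec Bool n
    y = fold x (act (sec² γ b)) q

  fold-act-enter : ∀ b c {n} (x : Vec Bool n) → ∃ λ m₀ → ∃ λ x′ → fold (b ∷ x) (act γ) m₀ ≡ c ∷ x′
  fold-act-enter false false x = 0 , x , refl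
  fold-act-enter true  true  x = 0 , x , refl
  fold-act-enter false true  x = 1 , _ , act-swap false x
  fold-act-enter true  false x = 1 , _ , act-swap true x

  fold-act-return : ∀ m b {n} (x y : Vec Bool n) → fold (b ∷ x) (act γ) m ≡ b ∷ y →
                    ∃ λ q → m ≡ q + q × fold x (act (sec² γ b)) q ≡ y
  fold-act-return m b x y eq with evenOdd m
  ... | even q = q , refl , cong tail (trans (sym (fold-act-even q b x)) eq)
  ... | odd q  = ⊥-elim (not-¬ refl (sym (begin
    not b                                          ≡⟨ cong head (act-swap b (fold x (act (sec² γ b)) q)) ⟨
    head (act γ (b ∷ fold x (act (sec² γ b)) q))   ≡⟨ cong (head ∘ act γ) (fold-act-even q b x) ⟨
    head (act γ (fold (b ∷ x) (act γ) (q + q)))    ≡⟨ cong head eq ⟩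
    b                                              ∎)))

-- labelParity n γ is the sign of the permutation γ induces on level n + 1.
labelParity : ℕ → Ω → Bool
labelParity zero    γ = γ []
labelParity (suc n) γ = labelParity n (sec γ false) xor labelParity n (sec γ true)

open CommutativeMonoidSum (CommutativeRing.+-commutativeMonoid xor-∧-commutativeRing)
  using (sum; sum-cong-≗; sum-permute)
open CommutativeSemigroupProperties (CommutativeRing.+-commutativeSemigroup xor-∧-commutativeRing)
  using (interchange)

xor-reindex : ∀ (A : Bool → Bool) c → A c xor A (not c) ≡ A false xor A true
xor-reindex A false = refl
xor-reindex A true  = xor-comm (A true) (A false)

labelParity-idΩ : ∀ n → labelParity n idΩ ≡ false
labelParity-idΩ zero    = refl
labelParity-idΩ (suc n) = cong₂ _xor_ (labelParity-idΩ n) (labelParity-idΩ n)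

labelParity-· : ∀ n g h → labelParity n (g · h) ≡ labelParity n g xor labelParity n h
labelParity-· zero    g h = xor-comm (h []) (g [])
-- sec (g · h) b reduces to sec g (b xor h []) · sec h b.
labelParity-· (suc n) g h = begin
  labelParity n (sec g c · sec h false) xor labelParity n (sec g (not c) · sec h true)
    ≡⟨ cong₂ _xor_ (labelParity-· n (sec g c) (sec h false)) (labelParity-· n (sec g (not c)) (sec h true)) ⟩
  (G c xor H false) xor (G (not c) xor H true)
    ≡⟨ interchange (G c) (H false) (G (not c)) (H true) ⟩
  (G c xor G (not c)) xor (H false xor H true)
    ≡⟨ cong (_xor (H false xor H true)) (xor-reindex G c) ⟩
  labelParity (suc n) g xor labelParity (suc n) h
    ∎
  where
  c : Bool
  c = h []
  G H : Bool → Bool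
  G b = labelParity n (sec g b)
  H b = labelParity n (sec h b)

labelParity-sec² : ∀ n γ b → labelParity n (sec² γ b) ≡ labelParity (suc n) γ
labelParity-sec² n γ b = begin
  labelParity n (sec² γ b)                                         ≡⟨ labelParity-· n (sec γ (not b)) (sec γ b) ⟩
  labelParity n (sec γ (not b)) xor labelParity n (sec γ b)        ≡⟨ xor-comm (labelParity n (sec γ (not b))) _ ⟩
  labelParity n (sec γ b) xor labelParity n (sec γ (not b))        ≡⟨ xor-reindex (labelParity n ∘ sec γ) b ⟩
  labelParity (suc n) γ                                            ∎

labelParity-pow-+ : ∀ n γ a b → labelParity n (pow γ (a + b)) ≡ labelParity n (pow γ a) xor labelParity n (pow γ b)
labelParity-pow-+ n γ zero    b = cong (_xor labelParity n (pow γ b)) (sym (labelParity-idΩ n))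
labelParity-pow-+ n γ (suc a) b = begin
  P (γ · pow γ (a + b))                   ≡⟨ labelParity-· n γ (pow γ (a + b)) ⟩
  P γ xor P (pow γ (a + b))               ≡⟨ cong (P γ xor_) (labelParity-pow-+ n γ a b) ⟩
  P γ xor (P (pow γ a) xor P (pow γ b))   ≡⟨ xor-assoc (P γ) (P (pow γ a)) (P (pow γ b)) ⟨
  (P γ xor P (pow γ a)) xor P (pow γ b)   ≡⟨ cong (_xor P (pow γ b)) (labelParity-· n γ (pow γ a)) ⟨
  P (pow γ (suc a)) xor P (pow γ b)       ∎
  where
  P : Ω → Bool
  P = labelParity n

labelParity-pow-odd : ∀ n γ q → labelParity n (pow γ (suc (q + q))) ≡ labelParity n γ
labelParity-pow-odd n γ q = begin
  labelParity n (γ · pow γ (q + q))                                 ≡⟨ labelParity-· n γ (pow γ (q + q)) ⟩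
  labelParity n γ xor labelParity n (pow γ (q + q))                 ≡⟨ cong (labelParity n γ xor_) (labelParity-pow-+ n γ q q) ⟩
  labelParity n γ xor (labelParity n (pow γ q) xor labelParity n (pow γ q))
    ≡⟨ cong (labelParity n γ xor_) (xor-same (labelParity n (pow γ q))) ⟩
  labelParity n γ xor false                                         ≡⟨ xor-identityʳ (labelParity n γ) ⟩
  labelParity n γ                                                   ∎

labelParity-prod : ∀ n k g → labelParity n (prod k g) ≡ sum (λ i → labelParity n (g i))
labelParity-prod n zero    g = labelParity-idΩ n
labelParity-prod n (suc k) g = trans (labelParity-· n (g F.zero) (prod k (g ∘ F.suc)))
  (cong (labelParity n (g F.zero) xor_) (labelParity-prod n k (g ∘ F.suc)))

labelParity-cong : ∀ n {g h} → (∀ (w : Vec Bool (suc n)) → act g w ≡ act h w) → labelParity n g ≡ labelParity n h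
labelParity-cong zero    agree = cong head (agree (false ∷ []))
labelParity-cong (suc n) agree = cong₂ _xor_
  (labelParity-cong n (λ w → cong tail (agree (false ∷ w))))
  (labelParity-cong n (λ w → cong tail (agree (true ∷ w))))

OddLevels : Ω → Set
OddLevels γ = ∀ n → labelParity n γ ≡ true

oddLevels-sec² : ∀ {γ} → OddLevels γ → ∀ b → OddLevels (sec² γ b)
oddLevels-sec² {γ} oddγ b n = trans (labelParity-sec² n γ b) (oddγ (suc n))

oddLevels⇒singleOrbit : ∀ {γ} → OddLevels γ → ∀ n → SingleOrbit (act γ {n})
oddLevels⇒singleOrbit oddγ zero [] [] = zero , refl
oddLevels⇒singleOrbit {γ} oddγ (suc n) (b ∷ x) (c ∷ y)
  with fold-act-enter {γ} (oddγ 0) b c x | oddLevels⇒singleOrbit (oddLevels-sec² oddγ c) n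
... | m₀ , x′ , entered | orbit with orbit x′ y
... | q , moved = q + q + m₀ , (begin
  fold (b ∷ x) (act γ) (q + q + m₀)                ≡⟨ fold-+ (b ∷ x) (act γ) (q + q) ⟩
  fold (fold (b ∷ x) (act γ) m₀) (act γ) (q + q)   ≡⟨ cong (λ v → fold v (act γ) (q + q)) entered ⟩
  fold (c ∷ x′) (act γ) (q + q)                    ≡⟨ fold-act-even {γ} (oddγ 0) q c x′ ⟩
  c ∷ fold x′ (act (sec² γ c)) q                   ≡⟨ cong (c ∷_) moved ⟩
  c ∷ y                                            ∎)

oddLevels⇒period : ∀ {γ} → OddLevels γ → ∀ n (x : Vec Bool n) → fold x (act γ) (2 ^ n) ≡ x
oddLevels⇒period oddγ zero    []      = refl
oddLevels⇒period {γ} oddγ (suc n) (b ∷ x) = begin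
  fold (b ∷ x) (act γ) (2 ^ n + (2 ^ n + 0))   ≡⟨ cong (λ m → fold (b ∷ x) (act γ) (2 ^ n + m)) (+-identityʳ (2 ^ n)) ⟩
  fold (b ∷ x) (act γ) (2 ^ n + 2 ^ n)         ≡⟨ fold-act-even {γ} (oddγ 0) (2 ^ n) b x ⟩
  b ∷ fold x (act (sec² γ b)) (2 ^ n)          ≡⟨ cong (b ∷_) (oddLevels⇒period (oddLevels-sec² oddγ b) n x) ⟩
  b ∷ x                                        ∎

oddLevels⇒period-∣ : ∀ {γ} → OddLevels γ → ∀ n (x : Vec Bool n) m → fold x (act γ) m ≡ x → 2 ^ n ∣ m
oddLevels⇒period-∣ oddγ zero    []      m _ = 1∣ m
oddLevels⇒period-∣ {γ} oddγ (suc n) (b ∷ x) m returns with fold-act-return {γ} (oddγ 0) m b x x returns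
... | q , refl , returnsBelow = subst (2 ^ suc n ∣_) (cong (q +_) (+-identityʳ q))
  (*-monoʳ-∣ 2 (oddLevels⇒period-∣ (oddLevels-sec² oddγ b) n x q returnsBelow))

oddLevels⇒isOdometer : ∀ {γ} → OddLevels γ → IsOdometer γ
oddLevels⇒isOdometer oddγ n _ = singleCycle-fromOrbit {{m^n≢0 2 n}} (replicate n false)
  (oddLevels⇒singleOrbit oddγ n (replicate n false))
  (oddLevels⇒period oddγ n (replicate n false))
  (oddLevels⇒period-∣ oddγ n)

singleOrbit⇒rootSwaps : ∀ {γ} n → SingleOrbit (act γ {suc n}) → γ [] ≡ true
singleOrbit⇒rootSwaps {γ} n orbit with orbit (false ∷ replicate n false) (true ∷ replicate n false)
... | m , reaches = ¬-not λ fixes → not-¬ refl (begin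
  false                                                ≡⟨ head-fold-act fixes m (false ∷ replicate n false) ⟨
  head (fold (false ∷ replicate n false) (act γ) m)    ≡⟨ cong head reaches ⟩
  true                                                 ∎)

singleOrbit-sec² : ∀ {γ} n → SingleOrbit (act γ {suc n}) → SingleOrbit (act (sec² γ false) {n})
singleOrbit-sec² {γ} n orbit x y with orbit (false ∷ x) (false ∷ y)
... | m , reaches with fold-act-return {γ} (singleOrbit⇒rootSwaps n orbit) m false x y reaches
... | q , _ , reachesBelow = q , reachesBelow

singleOrbit⇒labelParity : ∀ {γ} n → SingleOrbit (act γ {suc n}) → labelParity n γ ≡ true
singleOrbit⇒labelParity zero        orbit = singleOrbit⇒rootSwaps zero orbit
singleOrbit⇒labelParity {γ} (suc n) orbit = trans (sym (labelParity-sec² n γ false))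
  (singleOrbit⇒labelParity n (singleOrbit-sec² (suc n) orbit))

isOdometer⇒oddLevels : ∀ {γ} → IsOdometer γ → OddLevels γ
isOdometer⇒oddLevels odometer n = singleOrbit⇒labelParity n
  (singleCycle⇒singleOrbit {{m^n≢0 2 (suc n)}} (odometer (suc n) (s≤s z≤n)))

trunc-odd : ∀ {d} → IsUnit d → ∀ n → ∃ λ q → trunc d (suc n) ≡ suc (q + q)
trunc-odd unit zero rewrite unit = zero , refl
trunc-odd {d} unit (suc n) with trunc-odd unit n
... | q , eq = q + bit (d (suc n)) * 2 ^ n , (begin
  trunc d (suc n) + bit (d (suc n)) * 2 ^ suc n        ≡⟨ cong (_+ bit (d (suc n)) * 2 ^ suc n) eq ⟩
  suc (q + q) + bit (d (suc n)) * (2 * 2 ^ n)          ≡⟨ regroup q (bit (d (suc n))) (2 ^ n) ⟩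
  suc (q + bit (d (suc n)) * 2 ^ n + (q + bit (d (suc n)) * 2 ^ n)) ∎)
  where
  open +-*-Solver
  regroup : ∀ q b p → suc (q + q) + b * (2 * p) ≡ suc (q + b * p + (q + b * p))
  regroup = solve 3 (λ q b p → (con 1 :+ (q :+ q)) :+ b :* (con 2 :* p) := con 1 :+ (q :+ b :* p :+ (q :+ b :* p))) refl

labelParity-isPow : ∀ {γ ℓ δ} → IsUnit ℓ → IsPow γ ℓ δ → ∀ n → labelParity n δ ≡ labelParity n γ
labelParity-isPow {γ} {ℓ} {δ} unit converges n with converges (suc n)
... | N , agree with trunc-odd unit N
... | q , truncOdd = begin
  labelParity n δ                            ≡⟨ labelParity-cong n (agree (suc N) (n≤1+n N)) ⟨
  labelParity n (pow γ (trunc ℓ (suc N)))    ≡⟨ cong (labelParity n ∘ pow γ) truncOdd ⟩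
  labelParity n (pow γ (suc (q + q)))        ≡⟨ labelParity-pow-odd n γ q ⟩
  labelParity n γ                            ∎

oneℤ₂ : ℤ₂
oneℤ₂ zero    = true
oneℤ₂ (suc _) = false

trunc-oneℤ₂ : ∀ n → trunc oneℤ₂ (suc n) ≡ 1
trunc-oneℤ₂ zero    = refl
trunc-oneℤ₂ (suc n) = trans (+-identityʳ _) (trunc-oneℤ₂ n)

isPow-oneℤ₂ : ∀ γ → IsPow γ oneℤ₂ γ
isPow-oneℤ₂ γ m = 1 , agree
  where
  agree : ∀ n → 1 ≤ n → ∀ (w : Vec Bool m) → act (pow γ (trunc oneℤ₂ n)) w ≡ act γ w
  agree (suc n) _ w = trans (cong (λ k → act (pow γ k) w) (trunc-oneℤ₂ n)) (act-pow γ 1 w)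

labelParity-permutedPowers : ∀ {k} (g : Fin k → Ω) (τ : Permutation′ k) {ℓ : Fin k → ℤ₂} {δ : Fin k → Ω} →
  (∀ i → IsUnit (ℓ i)) → (∀ i → IsPow (g (τ ⟨$⟩ʳ i)) (ℓ i) (δ i)) →
  ∀ n → labelParity n (prod k δ) ≡ labelParity n (prod k g)
labelParity-permutedPowers {k} g τ {δ = δ} units powers n = begin
  labelParity n (prod k δ)                  ≡⟨ labelParity-prod n k δ ⟩
  sum (λ i → labelParity n (δ i))           ≡⟨ sum-cong-≗ (λ i → labelParity-isPow (units i) (powers i) n) ⟩
  sum (λ i → labelParity n (g (τ ⟨$⟩ʳ i)))  ≡⟨ sum-permute (λ i → labelParity n (g i)) τ ⟨
  sum (λ i → labelParity n (g i))           ≡⟨ labelParity-prod n k g ⟨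
  labelParity n (prod k g)                  ∎

lemma5p1 : (k : ℕ) (g : Fin k → Ω) →
    IsOdometer (prod k g) ⇔
      ((τ : Permutation′ k) (ℓ : Fin k → ℤ₂) → (∀ i → IsUnit (ℓ i)) →
        (δ : Fin k → Ω) → (∀ i → IsPow (g (τ ⟨$⟩ʳ i)) (ℓ i) (δ i)) →
        IsOdometer (prod k δ))
lemma5p1 k g = mk⇔
  (λ odometer τ ℓ units δ powers → oddLevels⇒isOdometer λ n →
    trans (labelParity-permutedPowers g τ units powers n) (isOdometer⇒oddLevels odometer n))
  (λ odometers → odometers Perm.id (λ _ → oneℤ₂) (λ _ → refl) g (isPow-oneℤ₂ ∘ g))
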